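{- Let $n\in\mathbb{N}_0$. Then \[ \sum_{k=0}^{n}(-1)^{k}\int_{\mathbb{Z}_p}\mathfrak{b}_k^n(x)\,d\mu_1(x)=\sum_{j=0}^{n}\binom{n}{j}(-2)^{n-j}B_{n-j}. \]
   Context: $p$ is an odd prime. For a polynomial $f:\mathbb{Z}_p\to\mathbb{C}_p$ the Volkenborn integral is $\int_{\mathbb{Z}_p} f(x)\,d\mu_1(x)=\lim_{N\to\infty}p^{ -N}\sum_{x=0}^{p^N-1}f(x)$. The Bernstein basis polynomials are $\mathfrak{b}_k^n(x)=\binom{n}{k}x^k(1-x)^{n-k}$ for $0\le k\le n$. The Bernoulli numbers $B_m$ are defined by $\frac{t}{e^t-1}=\sum_{m\ge0}B_m\frac{t^m}{m!}$. -}

module Defs where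

open import Data.Nat as ℕ using (ℕ; zero; suc; _≤_)
open import Data.Nat.Combinatorics using (_C_)
open import Data.Nat.Divisibility using (_∣_)
open import Data.Integer as ℤ using (ℤ; +_)
open import Data.Rational as ℚ using (ℚ; 0ℚ; 1ℚ; _+_; _*_; _-_; -_; _/_; ↥_; ↧ₙ_)
open import Data.List using (List; []; _∷_; _++_; zip; upTo; map; length)
open import Data.Product using (Σ; _×_; proj₁; proj₂; _,_)
open import Relation.Nullary using (¬_)

ℕ→ℚ : ℕ → ℚ
ℕ→ℚ n = (+ n) / 1

_^ℚ_ : ℚ → ℕ → ℚ
q ^ℚ zero = 1ℚ
q ^ℚ suc n = q * (q ^ℚ n)

-- p^(-N) as a rational (the case p = 0 is irrelevant; p will be prime)
invPow : ℕ → ℕ → ℚ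
invPow zero    N = 0ℚ
invPow (suc k) N = ((+ 1) / suc k) ^ℚ N

sumBelow : ℕ → (ℕ → ℚ) → ℚ
sumBelow zero    f = 0ℚ
sumBelow (suc M) f = sumBelow M f + f M

bernstein : ℕ → ℕ → ℚ → ℚ
bernstein n k x = ℕ→ℚ (n C k) * ((x ^ℚ k) * ((1ℚ - x) ^ℚ (n ℕ.∸ k)))

volkenbornSum : (p : ℕ) → (ℕ → ℚ) → ℕ → ℚ
volkenbornSum p f N = invPow p N * sumBelow (p ℕ.^ N) f

-- p-adic valuation of q is at least m  (q = 0 allowed), for q in lowest terms:
-- p^m divides the numerator and p does not divide the denominator.
valAtLeast : ℕ → ℕ → ℚ → Set
valAtLeast p m q = ((p ℕ.^ m) ∣ ℤ.∣ ↥ q ∣) × ¬ (p ∣ ↧ₙ q)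

ConvergesTo : ℕ → (ℕ → ℚ) → ℚ → Set
ConvergesTo p a L = ∀ (m : ℕ) → Σ ℕ (λ N₀ → ∀ (N : ℕ) → N₀ ≤ N → valAtLeast p m (a N - L))

-- "∫_{ℤ_p} f dμ₁ = I": the Volkenborn limit exists and equals I
VolkenbornIntegral : ℕ → (ℕ → ℚ) → ℚ → Set
VolkenbornIntegral p f I = ConvergesTo p (volkenbornSum p f) I

-- Bernoulli numbers (t/(e^t-1) convention, B₁ = -1/2) via the recurrence
-- Σ_{j=0}^{M} C(M+1,j) B_j = 0 for M ≥ 1, B₀ = 1.
private
  nextBern : ℕ → List ℚ → ℚ
  nextBern M L = - (((+ 1) / suc M) * go 0 L)
    where
    go : ℕ → List ℚ → ℚ
    go j []       = 0ℚ
    go j (b ∷ bs) = ℕ→ℚ (suc M C j) * b + go (suc j) bs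

  lastOr : ℚ → List ℚ → ℚ
  lastOr d []       = d
  lastOr d (x ∷ xs) = lastOr x xs

bernUpTo : ℕ → List ℚ
bernUpTo zero    = 1ℚ ∷ []
bernUpTo (suc m) = bernUpTo m ++ (nextBern (suc m) (bernUpTo m) ∷ [])

bernoulli : ℕ → ℚ
bernoulli m = lastOr 0ℚ (bernUpTo m)

sumTo : ℕ → (ℕ → ℚ) → ℚ
sumTo n f = sumBelow (suc n) f

signℚ : ℕ → ℚ
signℚ k = (- 1ℚ) ^ℚ k

{-# OPTIONS --safe #-}
-- The Riemann sums Vᵢ(N) = p⁻ᴺ Σ_{x<pᴺ} xⁱ satisfy exactly Σ_{j≤i} C(i+1,j) Vⱼ(N) = (pᴺ)ⁱ,
-- by telescoping (x+1)ⁱ⁺¹ − xⁱ⁺¹. This is the recurrence of the Bernoulli numbers perturbed by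
-- (pᴺ)ⁱ, which is p-adically small for i ≥ 1; solving it for Vᵢ₊₁ divides only by i+2, which
-- loses a bounded amount of valuation, so Vᵢ(N) → Bᵢ by strong induction. Expanding bₖⁿ in
-- monomials gives its integral, and Σₖ (−1)ᵏ bₖⁿ(x) = (1 − 2x)ⁿ; the alternating sum of the
-- integrals and the integral of (1 − 2x)ⁿ are limits of the same sequence, hence equal.
module Submission where

open import Defs
open import Data.Empty using (⊥-elim)
open import Data.Integer as ℤ using (+_)
import Data.Integer.Divisibility.Signed as ℤ∣
import Data.Integer.Properties as ℤₚ
import Data.Integer.Solver as ℤSolver
open import Data.List using (List; []; _∷_; _++_; length)
open import Data.List.Properties using (length-++)
open import Data.Nat as ℕ using (ℕ; zero; suc; _∸_; _≤_; _<_; s≤s; z≤n)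
open import Data.Nat.Combinatorics using (_C_)
import Data.Nat.Combinatorics as ℕC
open import Data.Nat.Divisibility
  using (_∣_; _∣?_; _∣0; divides; ∣⇒≤; ∣1⇒≡1; 1∣_; ∣-trans; m∣m*n; *-monoʳ-∣; *-cancelˡ-∣)
import Data.Nat.GCD as ℕGCD
open import Data.Nat.Induction using (<-rec)
open import Data.Nat.Primality using (Prime; euclidsLemma; ¬prime[0]; ¬prime[1])
import Data.Nat.Properties as ℕₚ
open import Data.Product using (Σ; _×_; _,_; proj₁)
open import Data.Rational using (ℚ; _+_; _*_; -_; _-_; _/_; 0ℚ; 1ℚ; ↥_; ↧_; ↧ₙ_; fromℚᵘ)
import Data.Rational.Properties as ℚₚ
open import Data.Rational.Solver using (module +-*-Solver)
open import Data.Rational.Unnormalised as ℚᵘ using (ℚᵘ; mkℚᵘ; *≡*)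
import Data.Rational.Unnormalised.Properties as ℚᵘₚ
open import Data.Sum using (inj₁; inj₂)
open import Function using (_∘_)
open import Relation.Binary.PropositionalEquality
  using (_≡_; _≢_; refl; sym; trans; cong; cong₂; subst; module ≡-Reasoning)
open import Relation.Nullary using (¬_; yes; no)

open +-*-Solver using (solve; _:+_; _:*_; :-_; _:-_; _:=_; con)
open ℤSolver.+-*-Solver using () renaming (_:*_ to _:*ᶻ_; _:=_ to _:=ᶻ_; con to conᶻ)

fromℚᵘ-homo-+ : ∀ x y → fromℚᵘ (x ℚᵘ.+ y) ≡ fromℚᵘ x + fromℚᵘ y
fromℚᵘ-homo-+ x y = ℚₚ.toℚᵘ-injective (ℚᵘₚ.≃-trans (ℚₚ.toℚᵘ-fromℚᵘ (x ℚᵘ.+ y))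
  (ℚᵘₚ.≃-trans (ℚᵘₚ.+-cong (ℚᵘₚ.≃-sym (ℚₚ.toℚᵘ-fromℚᵘ x)) (ℚᵘₚ.≃-sym (ℚₚ.toℚᵘ-fromℚᵘ y)))
               (ℚᵘₚ.≃-sym (ℚₚ.toℚᵘ-homo-+ (fromℚᵘ x) (fromℚᵘ y)))))

fromℚᵘ-homo-* : ∀ x y → fromℚᵘ (x ℚᵘ.* y) ≡ fromℚᵘ x * fromℚᵘ y
fromℚᵘ-homo-* x y = ℚₚ.toℚᵘ-injective (ℚᵘₚ.≃-trans (ℚₚ.toℚᵘ-fromℚᵘ (x ℚᵘ.* y))
  (ℚᵘₚ.≃-trans (ℚᵘₚ.*-cong (ℚᵘₚ.≃-sym (ℚₚ.toℚᵘ-fromℚᵘ x)) (ℚᵘₚ.≃-sym (ℚₚ.toℚᵘ-fromℚᵘ y)))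
               (ℚᵘₚ.≃-sym (ℚₚ.toℚᵘ-homo-* (fromℚᵘ x) (fromℚᵘ y)))))

fromℚᵘ-homo-neg : ∀ x → fromℚᵘ (ℚᵘ.- x) ≡ - fromℚᵘ x
fromℚᵘ-homo-neg x = ℚₚ.toℚᵘ-injective (ℚᵘₚ.≃-trans (ℚₚ.toℚᵘ-fromℚᵘ (ℚᵘ.- x))
  (ℚᵘₚ.≃-trans (ℚᵘₚ.-‿cong (ℚᵘₚ.≃-sym (ℚₚ.toℚᵘ-fromℚᵘ x)))
               (ℚᵘₚ.≃-sym (ℚₚ.toℚᵘ-homo‿- (fromℚᵘ x)))))

ℕ→ℚ-homo-+ : ∀ a b → ℕ→ℚ (a ℕ.+ b) ≡ ℕ→ℚ a + ℕ→ℚ b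
ℕ→ℚ-homo-+ a b = trans (ℚₚ.fromℚᵘ-cong {mkℚᵘ (+ (a ℕ.+ b)) 0} {a′ ℚᵘ.+ b′} (*≡* same)) (fromℚᵘ-homo-+ a′ b′)
  where
  a′ b′ : ℚᵘ
  a′ = mkℚᵘ (+ a) 0
  b′ = mkℚᵘ (+ b) 0
  same : + (a ℕ.+ b) ℤ.* + 1 ≡ (+ a ℤ.* + 1 ℤ.+ + b ℤ.* + 1) ℤ.* + 1
  same = cong (ℤ._* + 1) (trans (ℤₚ.pos-+ a b)
           (sym (cong₂ ℤ._+_ (ℤₚ.*-identityʳ (+ a)) (ℤₚ.*-identityʳ (+ b)))))

ℕ→ℚ-homo-* : ∀ a b → ℕ→ℚ (a ℕ.* b) ≡ ℕ→ℚ a * ℕ→ℚ b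
ℕ→ℚ-homo-* a b = trans (ℚₚ.fromℚᵘ-cong {mkℚᵘ (+ (a ℕ.* b)) 0} {a′ ℚᵘ.* b′} (*≡* (cong (ℤ._* + 1) (ℤₚ.pos-* a b))))
                        (fromℚᵘ-homo-* a′ b′)
  where
  a′ b′ : ℚᵘ
  a′ = mkℚᵘ (+ a) 0
  b′ = mkℚᵘ (+ b) 0

ℕ→ℚ-suc : ∀ a → ℕ→ℚ (suc a) ≡ ℕ→ℚ a + 1ℚ
ℕ→ℚ-suc a = trans (cong ℕ→ℚ (ℕₚ.+-comm 1 a)) (ℕ→ℚ-homo-+ a 1)

ℕ→ℚ-*-inverse : ∀ k → ℕ→ℚ (suc k) * ((+ 1) / suc k) ≡ 1ℚ
ℕ→ℚ-*-inverse k = trans (sym (fromℚᵘ-homo-* (mkℚᵘ (+ suc k) 0) (mkℚᵘ (+ 1) k)))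
                        (ℚₚ.fromℚᵘ-cong {mkℚᵘ (+ suc k) 0 ℚᵘ.* mkℚᵘ (+ 1) k} {mkℚᵘ (+ 1) 0} (*≡* same))
  where
  same : (+ suc k ℤ.* + 1) ℤ.* + 1 ≡ + 1 ℤ.* + (1 ℕ.* suc k)
  same = trans (ℤₚ.*-identityʳ _) (trans (ℤₚ.*-identityʳ _)
           (sym (trans (ℤₚ.*-identityˡ _) (cong +_ (ℕₚ.*-identityˡ (suc k))))))

ℕ→ℚ-homo-^ : ∀ a n → ℕ→ℚ (a ℕ.^ n) ≡ ℕ→ℚ a ^ℚ n
ℕ→ℚ-homo-^ a zero    = refl
ℕ→ℚ-homo-^ a (suc n) = trans (ℕ→ℚ-homo-* a (a ℕ.^ n)) (cong (ℕ→ℚ a *_) (ℕ→ℚ-homo-^ a n))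

^ℚ-distribˡ-+-* : ∀ x a b → x ^ℚ (a ℕ.+ b) ≡ x ^ℚ a * x ^ℚ b
^ℚ-distribˡ-+-* x zero    b = sym (ℚₚ.*-identityˡ _)
^ℚ-distribˡ-+-* x (suc a) b = trans (cong (x *_) (^ℚ-distribˡ-+-* x a b)) (sym (ℚₚ.*-assoc x _ _))

^ℚ-distribʳ-* : ∀ x y a → (x * y) ^ℚ a ≡ x ^ℚ a * y ^ℚ a
^ℚ-distribʳ-* x y zero    = refl
^ℚ-distribʳ-* x y (suc a) = trans (cong ((x * y) *_) (^ℚ-distribʳ-* x y a))
  (solve 4 (λ x y u v → (x :* y) :* (u :* v) := (x :* u) :* (y :* v)) refl x y (x ^ℚ a) (y ^ℚ a))

^ℚ-zeroˡ : ∀ a → 1ℚ ^ℚ a ≡ 1ℚ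
^ℚ-zeroˡ zero    = refl
^ℚ-zeroˡ (suc a) = cong (1ℚ *_) (^ℚ-zeroˡ a)

0^ℚsuc≡0 : ∀ a → 0ℚ ^ℚ suc a ≡ 0ℚ
0^ℚsuc≡0 a = ℚₚ.*-zeroˡ (0ℚ ^ℚ a)

neg-^ℚ : ∀ y l → (- y) ^ℚ l ≡ signℚ l * y ^ℚ l
neg-^ℚ y zero    = refl
neg-^ℚ y (suc l) = trans (cong ((- y) *_) (neg-^ℚ y l))
  (solve 3 (λ y s t → (:- y) :* (s :* t) := (con (- 1ℚ) :* s) :* (y :* t)) refl y (signℚ l) (y ^ℚ l))

invPow-*-p^N : ∀ k N → invPow (suc k) N * ℕ→ℚ (suc k ℕ.^ N) ≡ 1ℚ
invPow-*-p^N k N = begin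
  invPow (suc k) N * ℕ→ℚ (suc k ℕ.^ N)   ≡⟨ cong (invPow (suc k) N *_) (ℕ→ℚ-homo-^ (suc k) N) ⟩
  invPow (suc k) N * ℕ→ℚ (suc k) ^ℚ N    ≡⟨ sym (^ℚ-distribʳ-* ((+ 1) / suc k) (ℕ→ℚ (suc k)) N) ⟩
  ((+ 1) / suc k * ℕ→ℚ (suc k)) ^ℚ N     ≡⟨ cong (_^ℚ N) (trans (ℚₚ.*-comm ((+ 1) / suc k) (ℕ→ℚ (suc k)))
                                                              (ℕ→ℚ-*-inverse k)) ⟩
  1ℚ ^ℚ N                                ≡⟨ ^ℚ-zeroˡ N ⟩
  1ℚ                                     ∎
  where open ≡-Reasoning

-- Finite sums and the binomial theorem

sumBelow-congᵢ : ∀ M {f g : ℕ → ℚ} → (∀ x → x < M → f x ≡ g x) → sumBelow M f ≡ sumBelow M g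
sumBelow-congᵢ zero    f≡g = refl
sumBelow-congᵢ (suc M) f≡g =
  cong₂ _+_ (sumBelow-congᵢ M (λ x x<M → f≡g x (ℕₚ.m≤n⇒m≤1+n x<M))) (f≡g M ℕₚ.≤-refl)

sumBelow-cong : ∀ M {f g : ℕ → ℚ} → (∀ x → f x ≡ g x) → sumBelow M f ≡ sumBelow M g
sumBelow-cong M f≡g = sumBelow-congᵢ M (λ x _ → f≡g x)

sumBelow-zero : ∀ M → sumBelow M (λ _ → 0ℚ) ≡ 0ℚ
sumBelow-zero zero    = refl
sumBelow-zero (suc M) = cong (_+ 0ℚ) (sumBelow-zero M)

sumBelow-one : ∀ M → sumBelow M (λ _ → 1ℚ) ≡ ℕ→ℚ M
sumBelow-one zero    = refl
sumBelow-one (suc M) = trans (cong (_+ 1ℚ) (sumBelow-one M)) (sym (ℕ→ℚ-suc M))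

sumBelow-distrib-+ : ∀ M (f g : ℕ → ℚ) → sumBelow M (λ x → f x + g x) ≡ sumBelow M f + sumBelow M g
sumBelow-distrib-+ zero    f g = refl
sumBelow-distrib-+ (suc M) f g = trans (cong (_+ (f M + g M)) (sumBelow-distrib-+ M f g))
  (solve 4 (λ a b c d → (a :+ b) :+ (c :+ d) := (a :+ c) :+ (b :+ d)) refl
     (sumBelow M f) (sumBelow M g) (f M) (g M))

sumBelow-*ˡ : ∀ M c (f : ℕ → ℚ) → sumBelow M (λ x → c * f x) ≡ c * sumBelow M f
sumBelow-*ˡ zero    c f = sym (ℚₚ.*-zeroʳ c)
sumBelow-*ˡ (suc M) c f = trans (cong (_+ c * f M) (sumBelow-*ˡ M c f))
  (sym (ℚₚ.*-distribˡ-+ c (sumBelow M f) (f M)))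

sumBelow-suc : ∀ M (f : ℕ → ℚ) → sumBelow (suc M) f ≡ f 0 + sumBelow M (λ x → f (suc x))
sumBelow-suc zero    f = trans (ℚₚ.+-identityˡ (f 0)) (sym (ℚₚ.+-identityʳ (f 0)))
sumBelow-suc (suc M) f = trans (cong (_+ f (suc M)) (sumBelow-suc M f))
  (ℚₚ.+-assoc (f 0) (sumBelow M (λ x → f (suc x))) (f (suc M)))

sumBelow-swap : ∀ M K (g : ℕ → ℕ → ℚ) →
  sumBelow M (λ x → sumBelow K (λ j → g j x)) ≡ sumBelow K (λ j → sumBelow M (g j))
sumBelow-swap zero    K g = sym (sumBelow-zero K)
sumBelow-swap (suc M) K g = trans (cong (_+ sumBelow K (λ j → g j M)) (sumBelow-swap M K g))
  (sym (sumBelow-distrib-+ K (λ j → sumBelow M (g j)) (λ j → g j M)))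

sumBelow-telescope : ∀ M (f : ℕ → ℚ) → sumBelow M (λ x → f (suc x) - f x) ≡ f M - f 0
sumBelow-telescope zero    f = sym (ℚₚ.+-inverseʳ (f 0))
sumBelow-telescope (suc M) f = trans (cong (_+ (f (suc M) - f M)) (sumBelow-telescope M f))
  (solve 3 (λ a b c → (b :- a) :+ (c :- b) := c :- a) refl (f 0) (f M) (f (suc M)))

binomial : ∀ a b n → (a + b) ^ℚ n ≡ sumTo n (λ j → ℕ→ℚ (n C j) * (a ^ℚ j * b ^ℚ (n ∸ j)))
binomial a b zero    = solve 0 (con 1ℚ := con 0ℚ :+ con 1ℚ :* (con 1ℚ :* con 1ℚ)) refl
binomial a b (suc n) = begin
  (a + b) * (a + b) ^ℚ n                              ≡⟨ cong ((a + b) *_) (binomial a b n) ⟩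
  (a + b) * sumTo n T                                 ≡⟨ ℚₚ.*-distribʳ-+ (sumTo n T) a b ⟩
  a * sumTo n T + b * sumTo n T                       ≡⟨ cong₂ _+_ (sym (sumBelow-*ˡ (suc n) a T))
                                                                   (sym (sumBelow-*ˡ (suc n) b T)) ⟩
  sumTo n aT + sumTo n bT                             ≡⟨ cong (_+_ (sumTo n aT)) (sumBelow-suc n bT) ⟩
  sumTo n aT + (bT 0 + sumBelow n (λ j → bT (suc j))) ≡⟨ cong₂ (λ u t → sumTo n aT + (u + t))
                                                               bT-first (sumBelow-congᵢ n bT-shift) ⟩
  sumTo n aT + (T′ 0 + sumBelow n U)                  ≡⟨ solve 3 (λ x y z → x :+ (y :+ z) := y :+ (x :+ (z :+ con 0ℚ)))
                                                               refl (sumTo n aT) (T′ 0) (sumBelow n U) ⟩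
  T′ 0 + (sumTo n aT + (sumBelow n U + 0ℚ))           ≡⟨ cong (λ t → T′ 0 + (sumTo n aT + (sumBelow n U + t)))
                                                               (sym U-last) ⟩
  T′ 0 + (sumTo n aT + sumTo n U)                     ≡⟨ cong (_+_ (T′ 0)) (sym (sumBelow-distrib-+ (suc n) aT U)) ⟩
  T′ 0 + sumTo n (λ j → aT j + U j)                   ≡⟨ cong (_+_ (T′ 0)) (sumBelow-cong (suc n) pascal) ⟩
  T′ 0 + sumTo n (λ j → T′ (suc j))                   ≡⟨ sym (sumBelow-suc (suc n) T′) ⟩
  sumTo (suc n) T′                                    ∎
  where
  open ≡-Reasoning
  T T′ aT bT U : ℕ → ℚ
  T j = ℕ→ℚ (n C j) * (a ^ℚ j * b ^ℚ (n ∸ j))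
  T′ j = ℕ→ℚ (suc n C j) * (a ^ℚ j * b ^ℚ (suc n ∸ j))
  aT j = a * T j
  bT j = b * T j
  U j = ℕ→ℚ (n C suc j) * (a ^ℚ suc j * b ^ℚ (n ∸ j))
  bT-first : bT 0 ≡ T′ 0
  bT-first = solve 2 (λ b y → b :* (con 1ℚ :* (con 1ℚ :* y)) := con 1ℚ :* (con 1ℚ :* (b :* y))) refl b (b ^ℚ n)
  bT-shift : ∀ j → j < n → bT (suc j) ≡ U j
  bT-shift j j<n = trans
    (solve 4 (λ b c x y → b :* (c :* (x :* y)) := c :* (x :* (b :* y))) refl
       b (ℕ→ℚ (n C suc j)) (a ^ℚ suc j) (b ^ℚ (n ∸ suc j)))
    (cong (λ e → ℕ→ℚ (n C suc j) * (a ^ℚ suc j * b ^ℚ e)) (sym (ℕₚ.+-∸-assoc 1 j<n)))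
  U-last : U n ≡ 0ℚ
  U-last = trans (cong (λ c → ℕ→ℚ c * (a ^ℚ suc n * b ^ℚ (n ∸ n))) (ℕC.k>n⇒nCk≡0 (ℕₚ.n<1+n n)))
                 (ℚₚ.*-zeroˡ (a ^ℚ suc n * b ^ℚ (n ∸ n)))
  pascal : ∀ j → aT j + U j ≡ T′ (suc j)
  pascal j = trans
    (solve 5 (λ a c d x y → a :* (c :* (x :* y)) :+ d :* ((a :* x) :* y) := (c :+ d) :* ((a :* x) :* y)) refl
       a (ℕ→ℚ (n C j)) (ℕ→ℚ (n C suc j)) (a ^ℚ j) (b ^ℚ (n ∸ j)))
    (cong (λ c → c * (a ^ℚ suc j * b ^ℚ (n ∸ j)))
          (trans (sym (ℕ→ℚ-homo-+ (n C j) (n C suc j))) (cong ℕ→ℚ (ℕC.nCk+nC[k+1]≡[n+1]C[k+1] n j))))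

-- The Bernoulli recurrence

binomialWeightedSum : ℕ → ℕ → List ℚ → ℚ
binomialWeightedSum M j []       = 0ℚ
binomialWeightedSum M j (b ∷ bs) = ℕ→ℚ (M C j) * b + binomialWeightedSum M (suc j) bs

binomialWeightedSum-unique : ∀ M (G : ℕ → List ℚ → ℚ) →
  (∀ j → G j [] ≡ 0ℚ) → (∀ j b bs → G j (b ∷ bs) ≡ ℕ→ℚ (M C j) * b + G (suc j) bs) →
  ∀ j bs → G j bs ≡ binomialWeightedSum M j bs
binomialWeightedSum-unique M G G-[] G-∷ j []       = G-[] j
binomialWeightedSum-unique M G G-[] G-∷ j (b ∷ bs) =
  trans (G-∷ j b bs) (cong (_+_ (ℕ→ℚ (M C j) * b)) (binomialWeightedSum-unique M G G-[] G-∷ (suc j) bs))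

-- The helpers behind `bernoulli` are private to Defs. Each is named here by a
-- top-level meta variable, solved by unification once the with-abstractions expose
-- the helper applied to distinct variables.
mutual
  privateGo : ℕ → List ℚ → ℕ → List ℚ → ℚ
  privateGo = _

  bernUpTo-suc : ∀ m → bernUpTo (suc m) ≡
    bernUpTo m ++ (- ((+ 1) / suc (suc m) * binomialWeightedSum (suc (suc m)) 0 (bernUpTo m)) ∷ [])
  bernUpTo-suc m with bernUpTo m | (+ 1) / suc (suc m)
  ... | xs | c with zero
  ... | i with xs
  ... | []     = refl
  ... | b ∷ bs with b ∷ bs | suc i
  ... | P | j = cong (λ t → b ∷ bs ++ (- (c * (ℕ→ℚ (suc (suc m) C i) * b + t))) ∷ [])
                     (binomialWeightedSum-unique (suc (suc m)) (privateGo m P) (λ _ → refl) (λ _ _ _ → refl) j bs)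

mutual
  privateLastOr : ℚ → List ℚ → ℚ
  privateLastOr = _

  bernoulli≡lastOr : ∀ m → bernoulli m ≡ privateLastOr 0ℚ (bernUpTo m)
  bernoulli≡lastOr m with bernUpTo m | 0ℚ
  ... | xs | d = refl

lastOr-snoc : ∀ d xs y → privateLastOr d (xs ++ y ∷ []) ≡ y
lastOr-snoc d []       y = refl
lastOr-snoc d (x ∷ xs) y = lastOr-snoc x xs y

length-bernUpTo : ∀ m → length (bernUpTo m) ≡ suc m
length-bernUpTo zero    = refl
length-bernUpTo (suc m) =
  trans (length-++ (bernUpTo m)) (trans (cong (ℕ._+ 1) (length-bernUpTo m)) (ℕₚ.+-comm (suc m) 1))

binomialWeightedSum-snoc : ∀ M j xs y →
  binomialWeightedSum M j (xs ++ y ∷ []) ≡ binomialWeightedSum M j xs + ℕ→ℚ (M C (j ℕ.+ length xs)) * y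
binomialWeightedSum-snoc M j []       y =
  trans (ℚₚ.+-comm (ℕ→ℚ (M C j) * y) 0ℚ) (cong (λ t → 0ℚ + ℕ→ℚ (M C t) * y) (sym (ℕₚ.+-identityʳ j)))
binomialWeightedSum-snoc M j (b ∷ xs) y = begin
  ℕ→ℚ (M C j) * b + binomialWeightedSum M (suc j) (xs ++ y ∷ [])
    ≡⟨ cong (_+_ (ℕ→ℚ (M C j) * b)) (binomialWeightedSum-snoc M (suc j) xs y) ⟩
  ℕ→ℚ (M C j) * b + (binomialWeightedSum M (suc j) xs + ℕ→ℚ (M C (suc j ℕ.+ length xs)) * y)
    ≡⟨ sym (ℚₚ.+-assoc (ℕ→ℚ (M C j) * b) _ _) ⟩
  binomialWeightedSum M j (b ∷ xs) + ℕ→ℚ (M C (suc j ℕ.+ length xs)) * y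
    ≡⟨ cong (λ t → binomialWeightedSum M j (b ∷ xs) + ℕ→ℚ (M C t) * y) (sym (ℕₚ.+-suc j (length xs))) ⟩
  binomialWeightedSum M j (b ∷ xs) + ℕ→ℚ (M C (j ℕ.+ length (b ∷ xs))) * y ∎
  where open ≡-Reasoning

bernoulli-suc-unfold : ∀ m →
  bernoulli (suc m) ≡ - ((+ 1) / suc (suc m) * binomialWeightedSum (suc (suc m)) 0 (bernUpTo m))
bernoulli-suc-unfold m = trans (bernoulli≡lastOr (suc m))
  (trans (cong (privateLastOr 0ℚ) (bernUpTo-suc m)) (lastOr-snoc 0ℚ (bernUpTo m) _))

binomialWeightedSum-bernUpTo : ∀ M m →
  binomialWeightedSum M 0 (bernUpTo m) ≡ sumTo m (λ j → ℕ→ℚ (M C j) * bernoulli j)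
binomialWeightedSum-bernUpTo M zero    = ℚₚ.+-comm (ℕ→ℚ (M C 0) * 1ℚ) 0ℚ
binomialWeightedSum-bernUpTo M (suc m) = begin
  binomialWeightedSum M 0 (bernUpTo (suc m))
    ≡⟨ cong (binomialWeightedSum M 0) (bernUpTo-suc m) ⟩
  binomialWeightedSum M 0 (bernUpTo m ++ y ∷ [])
    ≡⟨ binomialWeightedSum-snoc M 0 (bernUpTo m) y ⟩
  binomialWeightedSum M 0 (bernUpTo m) + ℕ→ℚ (M C length (bernUpTo m)) * y
    ≡⟨ cong₂ (λ s l → s + ℕ→ℚ (M C l) * y) (binomialWeightedSum-bernUpTo M m) (length-bernUpTo m) ⟩
  sumTo m (λ j → ℕ→ℚ (M C j) * bernoulli j) + ℕ→ℚ (M C suc m) * y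
    ≡⟨ cong (λ t → sumTo m (λ j → ℕ→ℚ (M C j) * bernoulli j) + ℕ→ℚ (M C suc m) * t)
            (sym (bernoulli-suc-unfold m)) ⟩
  sumTo (suc m) (λ j → ℕ→ℚ (M C j) * bernoulli j) ∎
  where
  open ≡-Reasoning
  y : ℚ
  y = - ((+ 1) / suc (suc m) * binomialWeightedSum (suc (suc m)) 0 (bernUpTo m))

bernoulli-suc : ∀ m → bernoulli (suc m) ≡
  - ((+ 1) / suc (suc m) * sumTo m (λ j → ℕ→ℚ (suc (suc m) C j) * bernoulli j))
bernoulli-suc m = trans (bernoulli-suc-unfold m)
  (cong (λ t → - ((+ 1) / suc (suc m) * t)) (binomialWeightedSum-bernUpTo (suc (suc m)) m))

[1+n]Cn≡1+n : ∀ n → suc n C n ≡ suc n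
[1+n]Cn≡1+n n = trans (ℕC.nCk≡nC[n∸k] (ℕₚ.n≤1+n n))
  (trans (cong (suc n C_) (ℕₚ.m+n∸n≡m 1 n)) (ℕC.nC1≡n (suc n)))

x+K*v≡y⇒v≡[y-x]*c : ∀ {x y v} K c → K * c ≡ 1ℚ → x + K * v ≡ y → v ≡ (y - x) * c
x+K*v≡y⇒v≡[y-x]*c {x} {y} {v} K c Kc≡1 x+Kv≡y = begin
  v
    ≡⟨ solve 4 (λ x v K c → v := ((x :+ K :* v) :- x) :* c :+ v :* (con 1ℚ :- K :* c)) refl x v K c ⟩
  ((x + K * v) - x) * c + v * (1ℚ - K * c)
    ≡⟨ cong₂ (λ s t → (s - x) * c + v * (1ℚ - t)) x+Kv≡y Kc≡1 ⟩
  (y - x) * c + v * (1ℚ - 1ℚ)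
    ≡⟨ solve 3 (λ a v c → a :* c :+ v :* (con 1ℚ :- con 1ℚ) := a :* c) refl (y - x) v c ⟩
  (y - x) * c ∎
  where open ≡-Reasoning

-- Riemann sums of monomials

monomialSum : ℕ → ℕ → ℕ → ℚ
monomialSum p i = volkenbornSum p (λ x → ℕ→ℚ x ^ℚ i)

volkenbornSum-cong : ∀ p {f g : ℕ → ℚ} → (∀ x → f x ≡ g x) → ∀ N → volkenbornSum p f N ≡ volkenbornSum p g N
volkenbornSum-cong p f≡g N = cong (invPow p N *_) (sumBelow-cong (p ℕ.^ N) f≡g)

volkenbornSum-linear : ∀ p K (c : ℕ → ℚ) (f : ℕ → ℕ → ℚ) N →
  volkenbornSum p (λ x → sumTo K (λ l → c l * f l x)) N ≡ sumTo K (λ l → c l * volkenbornSum p (f l) N)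
volkenbornSum-linear p K c f N = begin
  ip * sumBelow M (λ x → sumTo K (λ l → c l * f l x))
    ≡⟨ cong (ip *_) (sumBelow-swap M (suc K) (λ l x → c l * f l x)) ⟩
  ip * sumTo K (λ l → sumBelow M (λ x → c l * f l x))
    ≡⟨ cong (ip *_) (sumBelow-cong (suc K) (λ l → sumBelow-*ˡ M (c l) (f l))) ⟩
  ip * sumTo K (λ l → c l * sumBelow M (f l))
    ≡⟨ sym (sumBelow-*ˡ (suc K) ip (λ l → c l * sumBelow M (f l))) ⟩
  sumTo K (λ l → ip * (c l * sumBelow M (f l)))
    ≡⟨ sumBelow-cong (suc K) (λ l → solve 3 (λ i c s → i :* (c :* s) := c :* (i :* s)) refl
                                              ip (c l) (sumBelow M (f l))) ⟩
  sumTo K (λ l → c l * (ip * sumBelow M (f l))) ∎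
  where
  open ≡-Reasoning
  M : ℕ
  M = p ℕ.^ N
  ip : ℚ
  ip = invPow p N

binomial-difference : ∀ x i → sumTo i (λ j → ℕ→ℚ (suc i C j) * x ^ℚ j) ≡ (x + 1ℚ) ^ℚ suc i - x ^ℚ suc i
binomial-difference x i = begin
  A                                  ≡⟨ solve 2 (λ a t → a := (a :+ t) :- t) refl A (x ^ℚ suc i) ⟩
  (A + x ^ℚ suc i) - x ^ℚ suc i      ≡⟨ cong (_- x ^ℚ suc i) (sym expand) ⟩
  (x + 1ℚ) ^ℚ suc i - x ^ℚ suc i     ∎
  where
  open ≡-Reasoning
  A : ℚ
  A = sumTo i (λ j → ℕ→ℚ (suc i C j) * x ^ℚ j)
  drop-1^ : ∀ j → ℕ→ℚ (suc i C j) * (x ^ℚ j * 1ℚ ^ℚ (suc i ∸ j)) ≡ ℕ→ℚ (suc i C j) * x ^ℚ j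
  drop-1^ j = cong (ℕ→ℚ (suc i C j) *_)
    (trans (cong (x ^ℚ j *_) (^ℚ-zeroˡ (suc i ∸ j))) (ℚₚ.*-identityʳ (x ^ℚ j)))
  top : ℕ→ℚ (suc i C suc i) * (x ^ℚ suc i * 1ℚ ^ℚ (suc i ∸ suc i)) ≡ x ^ℚ suc i
  top = trans (cong₂ (λ c e → ℕ→ℚ c * (x ^ℚ suc i * 1ℚ ^ℚ e)) (ℕC.nCn≡1 (suc i)) (ℕₚ.n∸n≡0 i))
        (solve 1 (λ y → con 1ℚ :* (y :* con 1ℚ) := y) refl (x ^ℚ suc i))
  expand : (x + 1ℚ) ^ℚ suc i ≡ A + x ^ℚ suc i
  expand = trans (binomial x 1ℚ (suc i)) (cong₂ _+_ (sumBelow-cong (suc i) drop-1^) top)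

powerSum-recurrence : ∀ M i → sumBelow M (λ x → sumTo i (λ j → ℕ→ℚ (suc i C j) * ℕ→ℚ x ^ℚ j)) ≡ ℕ→ℚ M ^ℚ suc i
powerSum-recurrence M i = begin
  sumBelow M (λ x → sumTo i (λ j → ℕ→ℚ (suc i C j) * ℕ→ℚ x ^ℚ j))
    ≡⟨ sumBelow-cong M (λ x → trans (binomial-difference (ℕ→ℚ x) i)
                                     (cong (λ t → t ^ℚ suc i - ℕ→ℚ x ^ℚ suc i) (sym (ℕ→ℚ-suc x)))) ⟩
  sumBelow M (λ x → ℕ→ℚ (suc x) ^ℚ suc i - ℕ→ℚ x ^ℚ suc i)
    ≡⟨ sumBelow-telescope M (λ x → ℕ→ℚ x ^ℚ suc i) ⟩
  ℕ→ℚ M ^ℚ suc i - 0ℚ ^ℚ suc i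
    ≡⟨ cong (_-_ (ℕ→ℚ M ^ℚ suc i)) (0^ℚsuc≡0 i) ⟩
  ℕ→ℚ M ^ℚ suc i - 0ℚ
    ≡⟨ ℚₚ.+-identityʳ (ℕ→ℚ M ^ℚ suc i) ⟩
  ℕ→ℚ M ^ℚ suc i ∎
  where open ≡-Reasoning

monomialSum-recurrence : ∀ k i N →
  sumTo i (λ j → ℕ→ℚ (suc i C j) * monomialSum (suc k) j N) ≡ ℕ→ℚ (suc k ℕ.^ N) ^ℚ i
monomialSum-recurrence k i N = begin
  sumTo i (λ j → ℕ→ℚ (suc i C j) * monomialSum (suc k) j N)
    ≡⟨ sym (volkenbornSum-linear (suc k) i (λ j → ℕ→ℚ (suc i C j)) (λ j x → ℕ→ℚ x ^ℚ j) N) ⟩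
  invPow (suc k) N * sumBelow M (λ x → sumTo i (λ j → ℕ→ℚ (suc i C j) * ℕ→ℚ x ^ℚ j))
    ≡⟨ cong (invPow (suc k) N *_) (powerSum-recurrence M i) ⟩
  invPow (suc k) N * (ℕ→ℚ M * ℕ→ℚ M ^ℚ i)
    ≡⟨ sym (ℚₚ.*-assoc (invPow (suc k) N) (ℕ→ℚ M) (ℕ→ℚ M ^ℚ i)) ⟩
  (invPow (suc k) N * ℕ→ℚ M) * ℕ→ℚ M ^ℚ i
    ≡⟨ cong (_* ℕ→ℚ M ^ℚ i) (invPow-*-p^N k N) ⟩
  1ℚ * ℕ→ℚ M ^ℚ i
    ≡⟨ ℚₚ.*-identityˡ (ℕ→ℚ M ^ℚ i) ⟩
  ℕ→ℚ M ^ℚ i ∎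
  where
  open ≡-Reasoning
  M : ℕ
  M = suc k ℕ.^ N

monomialSum-zero : ∀ k N → monomialSum (suc k) 0 N ≡ 1ℚ
monomialSum-zero k N = trans (cong (invPow (suc k) N *_) (sumBelow-one (suc k ℕ.^ N))) (invPow-*-p^N k N)

monomialSum-suc : ∀ k i N → monomialSum (suc k) (suc i) N ≡
  (ℕ→ℚ (suc k ℕ.^ N) ^ℚ suc i - sumTo i (λ j → ℕ→ℚ (suc (suc i) C j) * monomialSum (suc k) j N))
  * ((+ 1) / suc (suc i))
monomialSum-suc k i N = x+K*v≡y⇒v≡[y-x]*c (ℕ→ℚ (suc (suc i))) ((+ 1) / suc (suc i)) (ℕ→ℚ-*-inverse (suc i))
  (trans (cong (λ c → sumTo i (λ j → ℕ→ℚ (suc (suc i) C j) * monomialSum (suc k) j N)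
                      + ℕ→ℚ c * monomialSum (suc k) (suc i) N) (sym ([1+n]Cn≡1+n (suc i))))
         (monomialSum-recurrence k (suc i) N))

-- Bernstein polynomials in the monomial basis

bernsteinCoeff : ℕ → ℕ → ℕ → ℚ
bernsteinCoeff n k l = ℕ→ℚ (n C k) * (ℕ→ℚ ((n ∸ k) C l) * signℚ l)

bernstein-monomials : ∀ n k y →
  bernstein n k y ≡ sumTo (n ∸ k) (λ l → bernsteinCoeff n k l * y ^ℚ (k ℕ.+ l))
bernstein-monomials n k y = begin
  ℕ→ℚ (n C k) * (y ^ℚ k * (1ℚ - y) ^ℚ m)
    ≡⟨ cong (λ t → ℕ→ℚ (n C k) * (y ^ℚ k * t ^ℚ m)) (ℚₚ.+-comm 1ℚ (- y)) ⟩
  ℕ→ℚ (n C k) * (y ^ℚ k * ((- y) + 1ℚ) ^ℚ m)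
    ≡⟨ cong (λ t → ℕ→ℚ (n C k) * (y ^ℚ k * t)) (binomial (- y) 1ℚ m) ⟩
  ℕ→ℚ (n C k) * (y ^ℚ k * sumTo m T)
    ≡⟨ cong (ℕ→ℚ (n C k) *_) (sym (sumBelow-*ˡ (suc m) (y ^ℚ k) T)) ⟩
  ℕ→ℚ (n C k) * sumTo m (λ l → y ^ℚ k * T l)
    ≡⟨ sym (sumBelow-*ˡ (suc m) (ℕ→ℚ (n C k)) (λ l → y ^ℚ k * T l)) ⟩
  sumTo m (λ l → ℕ→ℚ (n C k) * (y ^ℚ k * T l))
    ≡⟨ sumBelow-cong (suc m) regroup ⟩
  sumTo m (λ l → bernsteinCoeff n k l * y ^ℚ (k ℕ.+ l)) ∎
  where
  open ≡-Reasoning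
  m : ℕ
  m = n ∸ k
  T : ℕ → ℚ
  T l = ℕ→ℚ (m C l) * ((- y) ^ℚ l * 1ℚ ^ℚ (m ∸ l))
  regroup : ∀ l → ℕ→ℚ (n C k) * (y ^ℚ k * T l) ≡ bernsteinCoeff n k l * y ^ℚ (k ℕ.+ l)
  regroup l = trans (cong₂ (λ u v → ℕ→ℚ (n C k) * (y ^ℚ k * (ℕ→ℚ (m C l) * (u * v)))) (neg-^ℚ y l) (^ℚ-zeroˡ (m ∸ l)))
    (trans (solve 5 (λ a yk b s yl → a :* (yk :* (b :* ((s :* yl) :* con 1ℚ))) := (a :* (b :* s)) :* (yk :* yl)) refl
                  (ℕ→ℚ (n C k)) (y ^ℚ k) (ℕ→ℚ (m C l)) (signℚ l) (y ^ℚ l))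
           (cong (bernsteinCoeff n k l *_) (sym (^ℚ-distribˡ-+-* y k l))))

bernsteinIntegral : ℕ → ℕ → ℚ
bernsteinIntegral n k = sumTo (n ∸ k) (λ l → bernsteinCoeff n k l * bernoulli (k ℕ.+ l))

alternating-bernstein : ∀ n y → sumTo n (λ k → signℚ k * bernstein n k y) ≡
  sumTo n (λ j → (ℕ→ℚ (n C j) * ((- 1ℚ) + (- 1ℚ)) ^ℚ (n ∸ j)) * y ^ℚ (n ∸ j))
alternating-bernstein n y = begin
  sumTo n (λ k → signℚ k * bernstein n k y)
    ≡⟨ sumBelow-cong (suc n) absorb-sign ⟩
  sumTo n (λ k → ℕ→ℚ (n C k) * ((- y) ^ℚ k * (1ℚ - y) ^ℚ (n ∸ k)))
    ≡⟨ sym (binomial (- y) (1ℚ - y) n) ⟩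
  ((- y) + (1ℚ - y)) ^ℚ n
    ≡⟨ cong (_^ℚ n) (solve 1 (λ y → :- y :+ (con 1ℚ :- y) := con 1ℚ :+ (con (- 1ℚ) :+ con (- 1ℚ)) :* y) refl y) ⟩
  (1ℚ + minusTwo * y) ^ℚ n
    ≡⟨ binomial 1ℚ (minusTwo * y) n ⟩
  sumTo n (λ j → ℕ→ℚ (n C j) * (1ℚ ^ℚ j * (minusTwo * y) ^ℚ (n ∸ j)))
    ≡⟨ sumBelow-cong (suc n) regroup ⟩
  sumTo n (λ j → (ℕ→ℚ (n C j) * minusTwo ^ℚ (n ∸ j)) * y ^ℚ (n ∸ j)) ∎
  where
  open ≡-Reasoning
  minusTwo : ℚ
  minusTwo = (- 1ℚ) + (- 1ℚ)
  absorb-sign : ∀ k → signℚ k * bernstein n k y ≡ ℕ→ℚ (n C k) * ((- y) ^ℚ k * (1ℚ - y) ^ℚ (n ∸ k))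
  absorb-sign k = trans
    (solve 4 (λ s c a b → s :* (c :* (a :* b)) := c :* ((s :* a) :* b)) refl
       (signℚ k) (ℕ→ℚ (n C k)) (y ^ℚ k) ((1ℚ - y) ^ℚ (n ∸ k)))
    (cong (λ t → ℕ→ℚ (n C k) * (t * (1ℚ - y) ^ℚ (n ∸ k))) (sym (neg-^ℚ y k)))
  regroup : ∀ j → ℕ→ℚ (n C j) * (1ℚ ^ℚ j * (minusTwo * y) ^ℚ (n ∸ j))
                  ≡ (ℕ→ℚ (n C j) * minusTwo ^ℚ (n ∸ j)) * y ^ℚ (n ∸ j)
  regroup j = trans (cong₂ (λ u v → ℕ→ℚ (n C j) * (u * v)) (^ℚ-zeroˡ j) (^ℚ-distribʳ-* minusTwo y (n ∸ j)))
    (solve 3 (λ c a b → c :* (con 1ℚ :* (a :* b)) := (c :* a) :* b) refl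
       (ℕ→ℚ (n C j)) (minusTwo ^ℚ (n ∸ j)) (y ^ℚ (n ∸ j)))

-- p-adic convergence

module PAdic (k : ℕ) (p-prime : Prime (suc (suc k))) where

  p : ℕ
  p = suc (suc k)

  p∤1 : ¬ (p ∣ 1)
  p∤1 p∣1 with ∣1⇒≡1 p∣1
  ... | ()

  p∤m*n : ∀ {a b} → ¬ (p ∣ a) → ¬ (p ∣ b) → ¬ (p ∣ a ℕ.* b)
  p∤m*n {a} {b} p∤a p∤b p∣ab with euclidsLemma a b p-prime p∣ab
  ... | inj₁ p∣a = p∤a p∣a
  ... | inj₂ p∣b = p∤b p∣b

  p^-mono-∣ : ∀ {j m} → j ≤ m → p ℕ.^ j ∣ p ℕ.^ m
  p^-mono-∣ {j} {m} j≤m = divides (p ℕ.^ (m ∸ j))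
    (trans (cong (p ℕ.^_) (sym (ℕₚ.m∸n+n≡m j≤m))) (ℕₚ.^-distribˡ-+-* p (m ∸ j) j))

  p^-cancelʳ-∣ : ∀ m x y → ¬ (p ∣ y) → p ℕ.^ m ∣ x ℕ.* y → p ℕ.^ m ∣ x
  p^-cancelʳ-∣ zero    x y p∤y _ = 1∣ x
  p^-cancelʳ-∣ (suc m) x y p∤y h with euclidsLemma x y p-prime (∣-trans (m∣m*n (p ℕ.^ m)) h)
  ... | inj₂ p∣y = ⊥-elim (p∤y p∣y)
  ... | inj₁ (divides x′ refl) = subst (p ℕ.* p ℕ.^ m ∣_) (ℕₚ.*-comm p x′)
    (*-monoʳ-∣ p (p^-cancelʳ-∣ m x′ y p∤y (*-cancelˡ-∣ p (subst (p ℕ.* p ℕ.^ m ∣_) reassoc h))))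
    where
    reassoc : x′ ℕ.* p ℕ.* y ≡ p ℕ.* (x′ ℕ.* y)
    reassoc = trans (cong (ℕ._* y) (ℕₚ.*-comm x′ p)) (ℕₚ.*-assoc p x′ y)

  n<p^n : ∀ n → n < p ℕ.^ n
  n<p^n zero    = s≤s z≤n
  n<p^n (suc n) = ℕₚ.<-≤-trans (s≤s (n<p^n n))
    (subst (suc (p ℕ.^ n) ≤_) (ℕₚ.*-comm (p ℕ.^ n) p) (ℕₚ.m<m*n (p ℕ.^ n) p (s≤s (s≤s z≤n))))
    where instance _ = ℕₚ.m^n≢0 p n

  split-p-power : ∀ fuel K → K < fuel → Σ ℕ λ e → Σ ℕ λ d → (suc K ≡ p ℕ.^ e ℕ.* suc d) × ¬ (p ∣ suc d)
  split-p-power (suc fuel) K (s≤s K<fuel) with p ∣? suc K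
  ... | no p∤K = 0 , K , sym (ℕₚ.+-identityʳ (suc K)) , p∤K
  ... | yes (divides zero ())
  ... | yes (divides (suc q) K≡qp) with split-p-power fuel q (ℕₚ.<-≤-trans q<K K<fuel)
    where
    q<K : q < K
    q<K = subst (q <_) (sym (ℕₚ.suc-injective K≡qp))
            (s≤s (ℕₚ.≤-trans (ℕₚ.m≤m*n q p) (ℕₚ.m≤n+m (q ℕ.* p) k)))
  ... | e , d , q≡p^ed , p∤d = suc e , d , trans K≡qp (trans (cong (ℕ._* p) q≡p^ed) reassoc) , p∤d
    where
    reassoc : p ℕ.^ e ℕ.* suc d ℕ.* p ≡ p ℕ.* p ℕ.^ e ℕ.* suc d
    reassoc = trans (ℕₚ.*-comm (p ℕ.^ e ℕ.* suc d) p) (sym (ℕₚ.*-assoc p (p ℕ.^ e) (suc d)))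

  -- Unlike `valAtLeast`, which reads the reduced fraction, a witness may use any
  -- representation a / d with p ∤ d; this makes it closed under the ring operations.
  record HasVal≥ (m : ℕ) (q : ℚ) : Set where
    constructor hasVal≥
    field
      repr      : ℚᵘ
      q≡repr    : q ≡ fromℚᵘ repr
      p^m∣num   : + (p ℕ.^ m) ℤ∣.∣ ℚᵘ.↥ repr
      p∤den     : ¬ (p ∣ ℚᵘ.↧ₙ repr)

  hasVal≥-0ℚ : ∀ m → HasVal≥ m 0ℚ
  hasVal≥-0ℚ m = hasVal≥ (mkℚᵘ (+ 0) 0) refl (ℤ∣.∣ᵤ⇒∣ ((p ℕ.^ m) ∣0)) p∤1

  hasVal≥-ℕ : ∀ n → HasVal≥ 0 (ℕ→ℚ n)
  hasVal≥-ℕ n = hasVal≥ (mkℚᵘ (+ n) 0) refl (ℤ∣.∣ᵤ⇒∣ (1∣ n)) p∤1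

  hasVal≥-p^ : ∀ {m N} → m ≤ N → HasVal≥ m (ℕ→ℚ (p ℕ.^ N))
  hasVal≥-p^ {N = N} m≤N = hasVal≥ (mkℚᵘ (+ (p ℕ.^ N)) 0) refl (ℤ∣.∣ᵤ⇒∣ (p^-mono-∣ m≤N)) p∤1

  hasVal≥-+ : ∀ {m x y} → HasVal≥ m x → HasVal≥ m y → HasVal≥ m (x + y)
  hasVal≥-+ (hasVal≥ r@(mkℚᵘ a d) eq p^m∣a p∤d) (hasVal≥ s@(mkℚᵘ b e) eq′ p^m∣b p∤e) =
    hasVal≥ (r ℚᵘ.+ s) (trans (cong₂ _+_ eq eq′) (sym (fromℚᵘ-homo-+ r s)))
      (ℤ∣.∣m∣n⇒∣m+n (ℤ∣.∣m⇒∣m*n (+ suc e) p^m∣a) (ℤ∣.∣m⇒∣m*n (+ suc d) p^m∣b)) (p∤m*n p∤d p∤e)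

  hasVal≥-neg : ∀ {m x} → HasVal≥ m x → HasVal≥ m (- x)
  hasVal≥-neg (hasVal≥ r@(mkℚᵘ a d) eq p^m∣a p∤d) =
    hasVal≥ (ℚᵘ.- r) (trans (cong -_ eq) (sym (fromℚᵘ-homo-neg r))) (ℤ∣.∣m⇒∣-m p^m∣a) p∤d

  hasVal≥-* : ∀ {m j x y} → HasVal≥ m x → HasVal≥ j y → HasVal≥ (m ℕ.+ j) (x * y)
  hasVal≥-* {m} {j} (hasVal≥ r@(mkℚᵘ a d) eq p^m∣a p∤d) (hasVal≥ s@(mkℚᵘ b e) eq′ p^j∣b p∤e) =
    hasVal≥ (r ℚᵘ.* s) (trans (cong₂ _*_ eq eq′) (sym (fromℚᵘ-homo-* r s)))
      (subst (ℤ∣._∣ a ℤ.* b) (sym p^[m+j]) (ℤ∣.∣-trans (ℤ∣.*-monoʳ-∣ (+ (p ℕ.^ m)) p^j∣b) (ℤ∣.*-monoˡ-∣ b p^m∣a)))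
      (p∤m*n p∤d p∤e)
    where
    p^[m+j] : + (p ℕ.^ (m ℕ.+ j)) ≡ + (p ℕ.^ m) ℤ.* + (p ℕ.^ j)
    p^[m+j] = trans (cong +_ (ℕₚ.^-distribˡ-+-* p m j)) (ℤₚ.pos-* (p ℕ.^ m) (p ℕ.^ j))

  hasVal≥-*-integral : ∀ {m x y} → HasVal≥ m x → HasVal≥ 0 y → HasVal≥ m (x * y)
  hasVal≥-*-integral {m} {x} {y} v w = subst (λ t → HasVal≥ t (x * y)) (ℕₚ.+-identityʳ m) (hasVal≥-* v w)

  hasVal≥-^ : ∀ {x} e → HasVal≥ 0 x → HasVal≥ 0 (x ^ℚ e)
  hasVal≥-^ zero    _ = hasVal≥-ℕ 1
  hasVal≥-^ (suc e) x-integral = hasVal≥-* x-integral (hasVal≥-^ e x-integral)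

  hasVal≥-signℚ : ∀ l → HasVal≥ 0 (signℚ l)
  hasVal≥-signℚ l = hasVal≥-^ l (hasVal≥-neg (hasVal≥-ℕ 1))

  hasVal≥-*-1/ : ∀ {m e d c x} → suc c ≡ p ℕ.^ e ℕ.* suc d → ¬ (p ∣ suc d) →
    HasVal≥ (m ℕ.+ e) x → HasVal≥ m (x * ((+ 1) / suc c))
  hasVal≥-*-1/ {m} {e} {d} {c} c≡p^ed p∤d (hasVal≥ r@(mkℚᵘ a d′) refl p^[m+e]∣a p∤d′)
    with p^[m+e]∣a
  ... | ℤ∣.divides q refl =
    hasVal≥ r′ (trans (sym (fromℚᵘ-homo-* r (mkℚᵘ (+ 1) c))) (ℚₚ.fromℚᵘ-cong {r ℚᵘ.* mkℚᵘ (+ 1) c} {r′} (*≡* cross)))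
      (ℤ∣.∣n⇒∣m*n q ℤ∣.∣-refl) (p∤m*n p∤d′ p∤d)
    where
    open ≡-Reasoning
    P^m P^e : ℤ.ℤ
    P^m = + (p ℕ.^ m)
    P^e = + (p ℕ.^ e)
    r′ : ℚᵘ
    r′ = mkℚᵘ (q ℤ.* P^m) (ℕ.pred (suc d′ ℕ.* suc d))
    cross : (q ℤ.* + (p ℕ.^ (m ℕ.+ e)) ℤ.* + 1) ℤ.* + (suc d′ ℕ.* suc d) ≡ (q ℤ.* P^m) ℤ.* + (suc d′ ℕ.* suc c)
    cross = begin
      (q ℤ.* + (p ℕ.^ (m ℕ.+ e)) ℤ.* + 1) ℤ.* + (suc d′ ℕ.* suc d)
        ≡⟨ cong₂ (λ u v → (q ℤ.* u ℤ.* + 1) ℤ.* v)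
                 (trans (cong +_ (ℕₚ.^-distribˡ-+-* p m e)) (ℤₚ.pos-* (p ℕ.^ m) (p ℕ.^ e)))
                 (ℤₚ.pos-* (suc d′) (suc d)) ⟩
      (q ℤ.* (P^m ℤ.* P^e) ℤ.* + 1) ℤ.* (+ suc d′ ℤ.* + suc d)
        ≡⟨ ℤSolver.+-*-Solver.solve 5
             (λ Q A B D D′ → (Q :*ᶻ (A :*ᶻ B) :*ᶻ conᶻ (+ 1)) :*ᶻ (D′ :*ᶻ D) :=ᶻ (Q :*ᶻ A) :*ᶻ (D′ :*ᶻ (B :*ᶻ D)))
             refl q P^m P^e (+ suc d) (+ suc d′) ⟩
      (q ℤ.* P^m) ℤ.* (+ suc d′ ℤ.* (P^e ℤ.* + suc d))
        ≡⟨ cong (λ t → (q ℤ.* P^m) ℤ.* (+ suc d′ ℤ.* t))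
                (trans (sym (ℤₚ.pos-* (p ℕ.^ e) (suc d))) (cong +_ (sym c≡p^ed))) ⟩
      (q ℤ.* P^m) ℤ.* (+ suc d′ ℤ.* + suc c)
        ≡⟨ cong ((q ℤ.* P^m) ℤ.*_) (sym (ℤₚ.pos-* (suc d′) (suc c))) ⟩
      (q ℤ.* P^m) ℤ.* + (suc d′ ℕ.* suc c) ∎

  hasVal≥⇒valAtLeast : ∀ {m x} → HasVal≥ m x → valAtLeast p m x
  hasVal≥⇒valAtLeast {m} (hasVal≥ (mkℚᵘ a d) refl p^m∣a p∤d) = p^m∣↥x , p∤↧x
    where
    x : ℚ
    x = a / suc d
    g : ℕ
    g = ℕGCD.gcd ℤ.∣ a ∣ (suc d)
    ↥x*g : ℤ.∣ ↥ x ∣ ℕ.* g ≡ ℤ.∣ a ∣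
    ↥x*g = trans (sym (ℤₚ.abs-* (↥ x) (+ g))) (cong ℤ.∣_∣ (ℚₚ.↥-/ a (suc d)))
    ↧x*g : ↧ₙ x ℕ.* g ≡ suc d
    ↧x*g = trans (sym (ℤₚ.abs-* (↧ x) (+ g))) (cong ℤ.∣_∣ (ℚₚ.↧-/ a (suc d)))
    p∤↧x : ¬ (p ∣ ↧ₙ x)
    p∤↧x p∣↧x = p∤d (∣-trans p∣↧x (divides g (trans (sym ↧x*g) (ℕₚ.*-comm (↧ₙ x) g))))
    p∤g : ¬ (p ∣ g)
    p∤g p∣g = p∤d (∣-trans p∣g (divides (↧ₙ x) (sym ↧x*g)))
    p^m∣↥x : p ℕ.^ m ∣ ℤ.∣ ↥ x ∣
    p^m∣↥x = p^-cancelʳ-∣ m ℤ.∣ ↥ x ∣ g p∤g (subst (p ℕ.^ m ∣_) (sym ↥x*g) (ℤ∣.∣⇒∣ᵤ p^m∣a))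

  valAtLeast-all⇒≡0 : ∀ x → (∀ m → valAtLeast p m x) → x ≡ 0ℚ
  valAtLeast-all⇒≡0 x val with ℤ.∣ ↥ x ∣ in ∣↥x∣≡
  ... | zero  = ℚₚ.↥p≡0⇒p≡0 x (ℤₚ.∣i∣≡0⇒i≡0 ∣↥x∣≡)
  ... | suc t = ⊥-elim (ℕₚ.<-irrefl refl (ℕₚ.<-≤-trans (n<p^n (suc t)) (∣⇒≤ (proj₁ (val (suc t))))))

  record Tendsto (a : ℕ → ℚ) (L : ℚ) : Set where
    constructor tendsto
    field
      from  : ℕ → ℕ
      close : ∀ m N → from m ≤ N → HasVal≥ m (a N - L)
  open Tendsto

  tendsto⇒ConvergesTo : ∀ {a L} → Tendsto a L → ConvergesTo p a L
  tendsto⇒ConvergesTo a→L m = from a→L m , λ N → hasVal≥⇒valAtLeast ∘ close a→L m N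

  tendsto-cong : ∀ {a b L L′} → (∀ N → a N ≡ b N) → L ≡ L′ → Tendsto a L → Tendsto b L′
  tendsto-cong {L′ = L′} a≡b refl a→L = tendsto (from a→L) λ m N N₀≤N →
    subst (λ t → HasVal≥ m (t - L′)) (a≡b N) (close a→L m N N₀≤N)

  tendsto-const : ∀ L → Tendsto (λ _ → L) L
  tendsto-const L = tendsto (λ _ → 0) λ m _ _ → subst (HasVal≥ m) (sym (ℚₚ.+-inverseʳ L)) (hasVal≥-0ℚ m)

  tendsto-+ : ∀ {a b L M} → Tendsto a L → Tendsto b M → Tendsto (λ N → a N + b N) (L + M)
  tendsto-+ {a} {b} {L} {M} a→L b→M = tendsto (λ m → from a→L m ℕ.⊔ from b→M m) λ m N N₀≤N →
    subst (HasVal≥ m) (solve 4 (λ x y u v → (x :- u) :+ (y :- v) := (x :+ y) :- (u :+ v)) refl (a N) (b N) L M)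
      (hasVal≥-+ (close a→L m N (ℕₚ.≤-trans (ℕₚ.m≤m⊔n _ _) N₀≤N)) (close b→M m N (ℕₚ.≤-trans (ℕₚ.m≤n⊔m _ _) N₀≤N)))

  tendsto-- : ∀ {a b L M} → Tendsto a L → Tendsto b M → Tendsto (λ N → a N - b N) (L - M)
  tendsto-- {a} {b} {L} {M} a→L b→M = tendsto (λ m → from a→L m ℕ.⊔ from b→M m) λ m N N₀≤N →
    subst (HasVal≥ m) (solve 4 (λ x y u v → (x :- u) :+ :- (y :- v) := (x :- y) :- (u :- v)) refl (a N) (b N) L M)
      (hasVal≥-+ (close a→L m N (ℕₚ.≤-trans (ℕₚ.m≤m⊔n _ _) N₀≤N))
                 (hasVal≥-neg (close b→M m N (ℕₚ.≤-trans (ℕₚ.m≤n⊔m _ _) N₀≤N))))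

  tendsto-*ˡ : ∀ {a L} c → HasVal≥ 0 c → Tendsto a L → Tendsto (λ N → c * a N) (c * L)
  tendsto-*ˡ {a} {L} c c-integral a→L = tendsto (from a→L) λ m N N₀≤N →
    subst (HasVal≥ m) (solve 3 (λ x u c → (x :- u) :* c := c :* x :- c :* u) refl (a N) L c)
      (hasVal≥-*-integral (close a→L m N N₀≤N) c-integral)

  tendsto-*-1/ : ∀ {a L} c → Tendsto a L → Tendsto (λ N → a N * ((+ 1) / suc c)) (L * ((+ 1) / suc c))
  tendsto-*-1/ {a} {L} c a→L with split-p-power (suc c) c (ℕₚ.n<1+n c)
  ... | e , d , c≡p^ed , p∤d = tendsto (λ m → from a→L (m ℕ.+ e)) λ m N N₀≤N →
    subst (HasVal≥ m) (solve 3 (λ x u c → (x :- u) :* c := x :* c :- u :* c) refl (a N) L ((+ 1) / suc c))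
      (hasVal≥-*-1/ c≡p^ed p∤d (close a→L (m ℕ.+ e) N N₀≤N))

  tendsto-sum : ∀ K {a : ℕ → ℕ → ℚ} {L : ℕ → ℚ} → (∀ j → j < K → Tendsto (a j) (L j)) →
    Tendsto (λ N → sumBelow K (λ j → a j N)) (sumBelow K L)
  tendsto-sum zero    _   = tendsto-const 0ℚ
  tendsto-sum (suc K) a→L = tendsto-+ (tendsto-sum K (λ j j<K → a→L j (ℕₚ.m≤n⇒m≤1+n j<K))) (a→L K ℕₚ.≤-refl)

  tendsto-unique : ∀ {a L L′} → Tendsto a L → Tendsto a L′ → L ≡ L′
  tendsto-unique {a} {L} {L′} a→L a→L′ = begin
    L             ≡⟨ solve 2 (λ x y → x := y :- (y :- x)) refl L L′ ⟩
    L′ - (L′ - L) ≡⟨ cong (_-_ L′) (valAtLeast-all⇒≡0 (L′ - L) (λ m → hasVal≥⇒valAtLeast (close-both m))) ⟩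
    L′ - 0ℚ       ≡⟨ ℚₚ.+-identityʳ L′ ⟩
    L′            ∎
    where
    open ≡-Reasoning
    close-both : ∀ m → HasVal≥ m (L′ - L)
    close-both m = subst (HasVal≥ m) (solve 3 (λ x u v → (x :- u) :+ (:- (x :- v)) := v :- u) refl (a N) L L′)
      (hasVal≥-+ (close a→L m N (ℕₚ.m≤m⊔n _ _)) (hasVal≥-neg (close a→L′ m N (ℕₚ.m≤n⊔m _ _))))
      where
      N : ℕ
      N = from a→L m ℕ.⊔ from a→L′ m

  p^N^[1+i]-tendsto-0 : ∀ i → Tendsto (λ N → ℕ→ℚ (p ℕ.^ N) ^ℚ suc i) 0ℚ
  p^N^[1+i]-tendsto-0 i = tendsto (λ m → m) λ m N m≤N →
    subst (HasVal≥ m) (sym (ℚₚ.+-identityʳ _))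
      (hasVal≥-*-integral (hasVal≥-p^ m≤N) (subst (HasVal≥ 0) (ℕ→ℚ-homo-^ (p ℕ.^ N) i) (hasVal≥-ℕ ((p ℕ.^ N) ℕ.^ i))))

  monomialSum-tendsto : ∀ i → Tendsto (monomialSum p i) (bernoulli i)
  monomialSum-tendsto = <-rec (λ i → Tendsto (monomialSum p i) (bernoulli i)) step
    where
    step : ∀ i → (∀ {j} → j < i → Tendsto (monomialSum p j) (bernoulli j)) → Tendsto (monomialSum p i) (bernoulli i)
    step zero    _   = tendsto-cong (λ N → sym (monomialSum-zero (suc k) N)) refl (tendsto-const 1ℚ)
    step (suc i) rec = tendsto-cong (λ N → sym (monomialSum-suc (suc k) i N)) (sym B[1+i])
      (tendsto-*-1/ (suc i) (tendsto-- (p^N^[1+i]-tendsto-0 i)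
        (tendsto-sum (suc i) λ j j<1+i → tendsto-*ˡ _ (hasVal≥-ℕ (suc (suc i) C j)) (rec j<1+i))))
      where
      c S : ℚ
      c = (+ 1) / suc (suc i)
      S = sumTo i (λ j → ℕ→ℚ (suc (suc i) C j) * bernoulli j)
      B[1+i] : bernoulli (suc i) ≡ (0ℚ - S) * c
      B[1+i] = trans (bernoulli-suc i) (solve 2 (λ c s → :- (c :* s) := (con 0ℚ :- s) :* c) refl c S)

  polynomial-tendsto : ∀ K (c : ℕ → ℚ) (e : ℕ → ℕ) → (∀ l → HasVal≥ 0 (c l)) →
    Tendsto (volkenbornSum p (λ x → sumTo K (λ l → c l * ℕ→ℚ x ^ℚ e l))) (sumTo K (λ l → c l * bernoulli (e l)))
  polynomial-tendsto K c e c-integral =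
    tendsto-cong (λ N → sym (volkenbornSum-linear p K c (λ l x → ℕ→ℚ x ^ℚ e l) N)) refl
      (tendsto-sum (suc K) λ l _ → tendsto-*ˡ (c l) (c-integral l) (monomialSum-tendsto (e l)))

  bernstein-tendsto : ∀ n k → Tendsto (volkenbornSum p (λ x → bernstein n k (ℕ→ℚ x))) (bernsteinIntegral n k)
  bernstein-tendsto n k =
    tendsto-cong (λ N → sym (volkenbornSum-cong p (λ x → bernstein-monomials n k (ℕ→ℚ x)) N)) refl
      (polynomial-tendsto (n ∸ k) (bernsteinCoeff n k) (k ℕ.+_)
        (λ l → hasVal≥-* (hasVal≥-ℕ (n C k)) (hasVal≥-* (hasVal≥-ℕ ((n ∸ k) C l)) (hasVal≥-signℚ l))))

  alternating-bernsteinIntegral : ∀ n → sumTo n (λ k → signℚ k * bernsteinIntegral n k)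
    ≡ sumTo n (λ j → ℕ→ℚ (n C j) * (((- 1ℚ) + (- 1ℚ)) ^ℚ (n ∸ j) * bernoulli (n ∸ j)))
  alternating-bernsteinIntegral n = trans (tendsto-unique termwise expanded)
    (sumBelow-cong (suc n) λ j → ℚₚ.*-assoc (ℕ→ℚ (n C j)) (((- 1ℚ) + (- 1ℚ)) ^ℚ (n ∸ j)) (bernoulli (n ∸ j)))
    where
    b : ℕ → ℕ → ℚ
    b k x = bernstein n k (ℕ→ℚ x)
    coeff : ℕ → ℚ
    coeff j = ℕ→ℚ (n C j) * ((- 1ℚ) + (- 1ℚ)) ^ℚ (n ∸ j)
    termwise : Tendsto (λ N → sumTo n (λ k → signℚ k * volkenbornSum p (b k) N))
                       (sumTo n (λ k → signℚ k * bernsteinIntegral n k))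
    termwise = tendsto-sum (suc n) λ k _ → tendsto-*ˡ (signℚ k) (hasVal≥-signℚ k) (bernstein-tendsto n k)
    expanded : Tendsto (λ N → sumTo n (λ k → signℚ k * volkenbornSum p (b k) N))
                       (sumTo n (λ j → coeff j * bernoulli (n ∸ j)))
    expanded = tendsto-cong
      (λ N → trans (volkenbornSum-cong p (λ x → sym (alternating-bernstein n (ℕ→ℚ x))) N)
                   (volkenbornSum-linear p n signℚ b N))
      refl
      (polynomial-tendsto n coeff (n ∸_)
        (λ j → hasVal≥-* (hasVal≥-ℕ (n C j)) (hasVal≥-^ (n ∸ j) (hasVal≥-+ (hasVal≥-signℚ 1) (hasVal≥-signℚ 1)))))

mainTheorem6 : (p : ℕ) → Prime p → p ≢ 2 → (n : ℕ) →
    Σ (ℕ → ℚ) (λ I →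
      (∀ (k : ℕ) → k ≤ n → VolkenbornIntegral p (λ x → bernstein n k (ℕ→ℚ x)) (I k))
      × (sumTo n (λ k → signℚ k * I k)
         ≡ sumTo n (λ j → ℕ→ℚ (n C j) * (((- 1ℚ) + (- 1ℚ)) ^ℚ (n ∸ j) * bernoulli (n ∸ j)))))
mainTheorem6 zero          p-prime _ n = ⊥-elim (¬prime[0] p-prime)
mainTheorem6 (suc zero)    p-prime _ n = ⊥-elim (¬prime[1] p-prime)
mainTheorem6 (suc (suc k)) p-prime _ n =
  bernsteinIntegral n , (λ j _ → tendsto⇒ConvergesTo (bernstein-tendsto n j)) , alternating-bernsteinIntegral n
  where open PAdic k p-prime
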